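{- For any $n\geq2$ and $k\geq0$, the number of permutations $\pi\in\mathfrak{S}_{n}$ with $\mathrm{br}(\pi)=k$ and $\mathrm{ipk}(\pi)=0$ is equal to $2\binom{n-2}{k-1}$ (interpreted as $0$ when $k=0$), which is twice the number of permutations $\sigma\in\mathfrak{S}_{n-1}$ with $\mathrm{udr}(\sigma)=k$ and $\mathrm{ipk}(\sigma)=0$.
   Context: $\mathfrak{S}_n$ is the symmetric group on $[n]$. For $\pi\in\mathfrak{S}_n$, $i$ with $2\le i\le n-1$ is a peak if $\pi(i-1)<\pi(i)>\pi(i+1)$, $\mathrm{pk}(\pi)$ is the number of peaks, and $\mathrm{ipk}(\pi)=\mathrm{pk}(\pi^{ -1})$. A birun of $\pi$ (in one-line notation) is a maximal monotone (increasing or decreasing) consecutive subsequence; $\mathrm{br}(\pi)$ is the number of biruns. An up-down run is either a birun or the one-element subsequence $\pi(1)$ when $\pi(1)>\pi(2)$; $\mathrm{udr}(\pi)$ is the number of up-down runs (for the permutation in $\mathfrak{S}_1$, $\mathrm{udr}=1$). -}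

module Defs where

open import Data.Nat using (ℕ; zero; suc; _+_; _*_; _∸_; _<ᵇ_; _≡ᵇ_)
open import Data.Nat.Combinatorics using (_C_)
open import Data.Bool using (Bool; true; false; if_then_else_; _∧_; not)
open import Data.List using (List; []; _∷_; map; concatMap; length; upTo)

range1 : ℕ → List ℕ
range1 n = map suc (upTo n)

words : ℕ → ℕ → List (List ℕ)
words zero    n = [] ∷ []
words (suc m) n = concatMap (λ x → map (x ∷_) (words m n)) (range1 n)

elemᵇ : ℕ → List ℕ → Bool
elemᵇ x []       = false
elemᵇ x (y ∷ ys) = if x ≡ᵇ y then true else elemᵇ x ys

distinctᵇ : List ℕ → Bool
distinctᵇ []       = true
distinctᵇ (x ∷ xs) = not (elemᵇ x xs) ∧ distinctᵇ xs

filterᵇ : {A : Set} → (A → Bool) → List A → List A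
filterᵇ p []       = []
filterᵇ p (x ∷ xs) = if p x then x ∷ filterᵇ p xs else filterᵇ p xs

-- 𝔖_n, in one-line notation π(1) π(2) ... π(n): the words of length n
-- over [n] with pairwise distinct letters (each permutation exactly once)
Sym : ℕ → List (List ℕ)
Sym n = filterᵇ distinctᵇ (words n n)

countSym : ℕ → (List ℕ → Bool) → ℕ
countSym n p = length (filterᵇ p (Sym n))

-- 1-based position of the value j in the one-line word (0 if absent)
pos : ℕ → List ℕ → ℕ
pos j []       = zero
pos j (x ∷ xs) = if j ≡ᵇ x then 1 else suc (pos j xs)

inverse : List ℕ → List ℕ
inverse π = map (λ j → pos j π) (range1 (length π))

pk : List ℕ → ℕ
pk (a ∷ b ∷ c ∷ rest) =
  (if (a <ᵇ b) ∧ (c <ᵇ b) then 1 else 0) + pk (b ∷ c ∷ rest)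
pk _ = 0

ipk : List ℕ → ℕ
ipk π = pk (inverse π)

steps : List ℕ → List Bool
steps (a ∷ b ∷ rest) = (a <ᵇ b) ∷ steps (b ∷ rest)
steps _ = []

blocksFrom : Bool → List Bool → ℕ
blocksFrom s []       = 0
blocksFrom s (t ∷ ts) = (if t Data.Bool.xor s then 1 else 0) + blocksFrom t ts
  where import Data.Bool

blocks : List Bool → ℕ
blocks []       = 0
blocks (t ∷ ts) = suc (blocksFrom t ts)

-- biruns = maximal monotone consecutive segments (of length ≥ 2 for n ≥ 2);
-- they correspond exactly to the maximal blocks of equal steps
br : List ℕ → ℕ
br π = blocks (steps π)

-- up-down runs: the biruns, plus the initial run π(1) when π(1) > π(2);
-- udr = 1 for the permutation of 𝔖₁
udr : List ℕ → ℕ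
udr (a ∷ b ∷ rest) = br (a ∷ b ∷ rest) + (if b <ᵇ a then 1 else 0)
udr (a ∷ [])       = 1
udr []             = 0

choosePred : ℕ → ℕ → ℕ
choosePred m zero    = 0
choosePred m (suc j) = m C j

-- A permutation π has ipk π = 0 iff the positions of the values 1, …, n have
-- no peak.  Then every prefix of π consists of consecutive values: if the next
-- entry left a gap next to the values already read, the position function would
-- rise from them into the gap and fall again at that entry, producing a peak.
-- So after its first entry π repeatedly appends the successor of its maximum or
-- the predecessor of its minimum, and π is encoded bijectively by this up/down
-- word w of length n − 1, which is also the ascent/descent word of π.  Hence
-- br π is the number of blocks of w, and udr π is one more than the number of
-- letter changes in w read after an initial "up"; counting words by these
-- statistics gives 2·C(n−2, k−1) and C(n−2, k−1) respectively.

module Submission where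

open import Defs
open import Data.Bool using (Bool; true; false; T; if_then_else_; _∧_)
open import Data.Bool.Properties using (T?; T-≡; T-∧)
open import Data.Empty using (⊥; ⊥-elim)
open import Data.List using (List; []; _∷_; _++_; map; length; upTo; applyUpTo; filter; concatMap)
open import Data.List.Membership.Propositional using (_∈_; find; lose)
open import Data.List.Membership.Propositional.Properties
  using (∈-map⁺; ∈-map⁻; ∈-++⁺ˡ; ∈-++⁺ʳ; ∈-++⁻; ∈-filter⁺; ∈-filter⁻; ∈-upTo⁺; ∈-upTo⁻;
         ∈-concatMap⁺; ∈-concatMap⁻)
open import Data.List.Properties using (∷-injectiveˡ; ∷-injectiveʳ; length-map; length-upTo; map-∘; map-upTo)
open import Data.List.Relation.Binary.Subset.Propositional using (_⊆_)
open import Data.List.Relation.Unary.All using (All; []; _∷_)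
import Data.List.Relation.Unary.All as All
import Data.List.Relation.Unary.AllPairs as AllPairs
open import Data.List.Relation.Unary.AllPairs using ([]; _∷_)
open import Data.List.Relation.Unary.Any using (here; there; tail)
open import Data.List.Relation.Unary.Unique.Propositional using (Unique)
open import Data.List.Relation.Unary.Unique.Propositional.Properties using (map⁺; ++⁺; filter⁺; upTo⁺)
open import Data.Nat using (ℕ; zero; suc; pred; _+_; _*_; _∸_; _≤_; _<_; z≤n; s≤s; _≡ᵇ_; _<ᵇ_)
open import Data.Nat.Combinatorics using (_C_; nCk+nC[k+1]≡[n+1]C[k+1])
open import Data.Nat.Properties
  using (_≟_; _≤?_; _<?_; ≤-refl; ≤-reflexive; ≤-trans; ≤-antisym; ≤-pred; <-irrefl; <-asym; <-trans;
         <-≤-trans; ≤-<-trans; <⇒≤; <⇒≢; <⇒≱; >⇒≢; ≤∧≢⇒<; ≮⇒≥; ≰⇒>; 1+n≰n; n≤1+n; n<1+n;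
         m≤n⇒m≤1+n; m≤m+n; m≤n+m; m∸n≤m; m+n∸n≡m; m∸n+n≡m; m+n≡0⇒n≡0; +-comm; +-suc; +-identityʳ;
         suc-injective; 1+n≢0; 1+n≢n; ≡ᵇ⇒≡; ≡⇒≡ᵇ; <⇒<ᵇ; <ᵇ-reflects-<)
open import Data.List.Membership.DecPropositional _≟_ using (_∈?_)
open import Data.Product using (∃-syntax; _×_; _,_; proj₁; proj₂)
open import Data.Sum using (_⊎_; inj₁; inj₂; [_,_]′)
open import Function using (_∘_; _⇔_; mk⇔; Equivalence)
open import Relation.Binary.PropositionalEquality
  using (_≡_; _≢_; refl; sym; trans; cong; cong₂; subst; subst₂)
open import Relation.Nullary using (¬_; yes; no; Dec; _×-dec_; proof)
open import Relation.Nullary.Reflects using (ofʸ; ofⁿ)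

-- Boolean words counted by blocks

boolWords : ℕ → List (List Bool)
boolWords zero    = [] ∷ []
boolWords (suc m) = map (true ∷_) (boolWords m) ++ map (false ∷_) (boolWords m)

count : {A : Set} → (A → Bool) → List A → ℕ
count p xs = length (filterᵇ p xs)

count-++ : {A : Set} (p : A → Bool) (xs ys : List A) →
           count p (xs ++ ys) ≡ count p xs + count p ys
count-++ p []       ys = refl
count-++ p (x ∷ xs) ys with p x
... | true  = cong suc (count-++ p xs ys)
... | false = count-++ p xs ys

count-map : {A B : Set} (p : B → Bool) (f : A → B) (xs : List A) →
            count p (map f xs) ≡ count (p ∘ f) xs
count-map p f []       = refl
count-map p f (x ∷ xs) with p (f x)
... | true  = cong suc (count-map p f xs)
... | false = count-map p f xs

count-cong : {A : Set} {p q : A → Bool} → (∀ x → p x ≡ q x) → (xs : List A) →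
             count p xs ≡ count q xs
count-cong         _   []       = refl
count-cong {q = q} p≗q (x ∷ xs) rewrite p≗q x with q x
... | true  = cong suc (count-cong p≗q xs)
... | false = count-cong p≗q xs

count-none : {A : Set} {p : A → Bool} → (∀ x → p x ≡ false) → (xs : List A) → count p xs ≡ 0
count-none p≗false []       = refl
count-none p≗false (x ∷ xs) rewrite p≗false x = count-none p≗false xs

count-boolWords-suc : (p : List Bool → Bool) (m : ℕ) →
  count p (boolWords (suc m)) ≡ count (p ∘ (true ∷_)) (boolWords m) + count (p ∘ (false ∷_)) (boolWords m)
count-boolWords-suc p m =
  trans (count-++ p (map (true ∷_) (boolWords m)) _)
    (cong₂ _+_ (count-map p _ (boolWords m)) (count-map p _ (boolWords m)))

choosePred-pascal : ∀ m j → m C j + choosePred m j ≡ suc m C j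
choosePred-pascal m zero    = refl
choosePred-pascal m (suc j) = trans (+-comm (m C suc j) (m C j)) (nCk+nC[k+1]≡[n+1]C[k+1] m j)

-- The first letter either continues the block of s or starts a new one: Pascal's rule.
count-blocksFrom     : ∀ s m j → count (λ w → blocksFrom s w ≡ᵇ j) (boolWords m) ≡ m C j
count-suc-blocksFrom : ∀ s m j → count (λ w → suc (blocksFrom s w) ≡ᵇ j) (boolWords m) ≡ choosePred m j

count-blocksFrom s     zero    zero    = refl
count-blocksFrom s     zero    (suc j) = refl
count-blocksFrom true  (suc m) j =
  trans (count-boolWords-suc _ m)
    (trans (cong₂ _+_ (count-blocksFrom true m j) (count-suc-blocksFrom false m j))
      (choosePred-pascal m j))
count-blocksFrom false (suc m) j =
  trans (count-boolWords-suc _ m)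
    (trans (+-comm (count (λ w → suc (blocksFrom true w) ≡ᵇ j) (boolWords m)) _)
      (trans (cong₂ _+_ (count-blocksFrom false m j) (count-suc-blocksFrom true m j))
        (choosePred-pascal m j)))

count-suc-blocksFrom s m zero    = count-none (λ _ → refl) (boolWords m)
count-suc-blocksFrom s m (suc j) = count-blocksFrom s m j

count-blocks : ∀ m k → count (λ w → blocks w ≡ᵇ k) (boolWords (suc m)) ≡ 2 * choosePred m k
count-blocks m k =
  trans (count-boolWords-suc _ m)
    (trans (cong₂ _+_ (count-suc-blocksFrom true m k) (count-suc-blocksFrom false m k))
      (cong (choosePred m k +_) (sym (+-identityʳ _))))

filterᵇ≡filter : {A : Set} (p : A → Bool) (xs : List A) → filterᵇ p xs ≡ filter (T? ∘ p) xs
filterᵇ≡filter p []       = refl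
filterᵇ≡filter p (x ∷ xs) with p x
... | true  = cong (x ∷_) (filterᵇ≡filter p xs)
... | false = filterᵇ≡filter p xs

module _ {A : Set} (p : A → Bool) {xs : List A} where

  ∈-filterᵇ⁺ : ∀ {x} → x ∈ xs → T (p x) → x ∈ filterᵇ p xs
  ∈-filterᵇ⁺ x∈ px = subst (_ ∈_) (sym (filterᵇ≡filter p xs)) (∈-filter⁺ (T? ∘ p) x∈ px)

  ∈-filterᵇ⁻ : ∀ {x} → x ∈ filterᵇ p xs → x ∈ xs × T (p x)
  ∈-filterᵇ⁻ x∈ = ∈-filter⁻ (T? ∘ p) (subst (_ ∈_) (filterᵇ≡filter p xs) x∈)

  filterᵇ⁺ : Unique xs → Unique (filterᵇ p xs)
  filterᵇ⁺ u = subst Unique (sym (filterᵇ≡filter p xs)) (filter⁺ (T? ∘ p) u)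

remove-∈ : {A : Set} {x : A} {ys : List A} → x ∈ ys →
  ∃[ ys′ ] length ys ≡ suc (length ys′) × (∀ {z} → z ∈ ys → z ≢ x → z ∈ ys′)
remove-∈ {ys = y ∷ ys} (here refl) = ys , refl , λ z∈ z≢x → tail z≢x z∈
remove-∈ {ys = y ∷ ys} (there x∈) with ys′ , len , sub ← remove-∈ x∈ =
  y ∷ ys′ , cong suc len , λ where
    (here refl) _   → here refl
    (there z∈)  z≢x → there (sub z∈ z≢x)

Unique-⊆⇒length-≤ : {A : Set} {xs ys : List A} → Unique xs → xs ⊆ ys → length xs ≤ length ys
Unique-⊆⇒length-≤ {xs = []}     _           _  = z≤n
Unique-⊆⇒length-≤ {xs = x ∷ xs} (x∉ ∷ uxs) xs⊆ys with ys′ , len , sub ← remove-∈ (xs⊆ys (here refl)) =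
  subst (suc (length xs) ≤_) (sym len)
    (s≤s (Unique-⊆⇒length-≤ uxs (λ z∈ → sub (xs⊆ys (there z∈)) (λ z≡x → All.lookup x∉ z∈ (sym z≡x)))))

Unique-⊆-⊇⇒length-≡ : {A : Set} {xs ys : List A} → Unique xs → Unique ys → xs ⊆ ys → ys ⊆ xs →
                      length xs ≡ length ys
Unique-⊆-⊇⇒length-≡ uxs uys xs⊆ys ys⊆xs =
  ≤-antisym (Unique-⊆⇒length-≤ uxs xs⊆ys) (Unique-⊆⇒length-≤ uys ys⊆xs)

concatMap⁺ : {A B : Set} (f : A → List B) {xs : List A} → Unique xs → (∀ x → Unique (f x)) →
  (∀ {x x′ y} → y ∈ f x → y ∈ f x′ → x ≡ x′) → Unique (concatMap f xs)
concatMap⁺ f {[]}     _          _  _        = []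
concatMap⁺ f {x ∷ xs} (x∉ ∷ uxs) uf disjoint = ++⁺ (uf x) (concatMap⁺ f uxs uf disjoint) λ (y∈fx , y∈rest) →
  let x′ , x′∈ , y∈fx′ = find (∈-concatMap⁻ f {xs = xs} y∈rest) in All.lookup x∉ x′∈ (disjoint y∈fx y∈fx′)

elemᵇ⇒∈ : ∀ {x xs} → T (elemᵇ x xs) → x ∈ xs
elemᵇ⇒∈ {x} {y ∷ ys} h with x ≡ᵇ y in x≡ᵇy
... | true  = here (≡ᵇ⇒≡ x y (subst T (sym x≡ᵇy) _))
... | false = there (elemᵇ⇒∈ h)

∈⇒elemᵇ : ∀ {x xs} → x ∈ xs → T (elemᵇ x xs)
∈⇒elemᵇ {x} (here refl) with x ≡ᵇ x | ≡⇒≡ᵇ x x refl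
... | true | _ = _
∈⇒elemᵇ {x} {y ∷ _} (there x∈) with x ≡ᵇ y
... | true  = _
... | false = ∈⇒elemᵇ x∈

distinctᵇ⇒Unique : ∀ {xs} → T (distinctᵇ xs) → Unique xs
distinctᵇ⇒Unique {[]}     _ = []
distinctᵇ⇒Unique {x ∷ xs} d with elemᵇ x xs in x∉
... | true  = ⊥-elim d
... | false = All.tabulate (λ y∈ x≡y → subst T x∉ (∈⇒elemᵇ (subst (_∈ xs) (sym x≡y) y∈))) ∷ distinctᵇ⇒Unique d

Unique⇒distinctᵇ : ∀ {xs} → Unique xs → T (distinctᵇ xs)
Unique⇒distinctᵇ {[]}     _          = _
Unique⇒distinctᵇ {x ∷ xs} (x∉ ∷ uxs) with elemᵇ x xs in x∈
... | true  = ⊥-elim (All.lookup x∉ (elemᵇ⇒∈ (subst T (sym x∈) _)) refl)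
... | false = Unique⇒distinctᵇ uxs

InRange : ℕ → ℕ → Set
InRange n x = 1 ≤ x × x ≤ n

∈-range1⁺ : ∀ {n x} → InRange n x → x ∈ range1 n
∈-range1⁺ (s≤s z≤n , x≤n) = ∈-map⁺ suc (∈-upTo⁺ x≤n)

∈-range1⁻ : ∀ {n x} → x ∈ range1 n → InRange n x
∈-range1⁻ x∈ with i , i∈ , refl ← ∈-map⁻ suc x∈ = s≤s z≤n , ∈-upTo⁻ i∈

length-range1 : ∀ n → length (range1 n) ≡ n
length-range1 n = trans (length-map suc (upTo n)) (length-upTo n)

range1-⊆ : ∀ {n xs} → Unique xs → All (InRange n) xs → length xs ≡ n → range1 n ⊆ xs
range1-⊆ {n} {xs} uxs xs∈ len {j} j∈ with j ∈? xs
... | yes j∈xs = j∈xs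
... | no  j∉xs = ⊥-elim (<-irrefl refl (subst₂ _≤_ (cong suc len) (length-range1 n)
                          (Unique-⊆⇒length-≤ (j∉xs′ ∷ uxs) ⊆range1)))
  where
  j∉xs′ : All (j ≢_) xs
  j∉xs′ = All.tabulate λ y∈ j≡y → j∉xs (subst (_∈ xs) (sym j≡y) y∈)
  ⊆range1 : j ∷ xs ⊆ range1 n
  ⊆range1 (here refl) = j∈
  ⊆range1 (there y∈)  = ∈-range1⁺ (All.lookup xs∈ y∈)

∈-words⁺ : ∀ {m n z} → length z ≡ m → All (InRange n) z → z ∈ words m n
∈-words⁺ {zero}  {z = []}    _   _          = here refl
∈-words⁺ {suc m} {z = x ∷ z} len (x∈ ∷ z∈) =
  ∈-concatMap⁺ (λ x → map (x ∷_) (words m _))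
    (lose (∈-range1⁺ x∈) (∈-map⁺ (x ∷_) (∈-words⁺ (suc-injective len) z∈)))

∈-words⁻ : ∀ {m n z} → z ∈ words m n → length z ≡ m × All (InRange n) z
∈-words⁻ {zero}      (here refl) = refl , []
∈-words⁻ {suc m} {n} z∈
  with x , x∈ , z∈x∷ ← find (∈-concatMap⁻ (λ x → map (x ∷_) (words m n)) {xs = range1 n} z∈)
  with z′ , z′∈ , refl ← ∈-map⁻ (x ∷_) z∈x∷
  with len , z′∈n ← ∈-words⁻ z′∈ = cong suc len , ∈-range1⁻ x∈ ∷ z′∈n

words-Unique : ∀ m n → Unique (words m n)
words-Unique zero    n = [] ∷ []
words-Unique (suc m) n =
  concatMap⁺ _ (map⁺ suc-injective (upTo⁺ n)) (λ _ → map⁺ ∷-injectiveʳ (words-Unique m n)) sameHead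
  where
  sameHead : ∀ {x x′ y} → y ∈ map (x ∷_) (words m n) → y ∈ map (x′ ∷_) (words m n) → x ≡ x′
  sameHead y∈ y∈′ with _ , _ , refl ← ∈-map⁻ _ y∈ | _ , _ , eq ← ∈-map⁻ _ y∈′ = ∷-injectiveˡ eq

IsPerm : ℕ → List ℕ → Set
IsPerm n π = length π ≡ n × All (InRange n) π × Unique π

∈-Sym⁺ : ∀ {n π} → IsPerm n π → π ∈ Sym n
∈-Sym⁺ (len , π∈ , uπ) = ∈-filterᵇ⁺ distinctᵇ (∈-words⁺ len π∈) (Unique⇒distinctᵇ uπ)

∈-Sym⁻ : ∀ {n π} → π ∈ Sym n → IsPerm n π
∈-Sym⁻ π∈ with π∈words , dπ ← ∈-filterᵇ⁻ distinctᵇ π∈ with len , π∈n ← ∈-words⁻ π∈words =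
  len , π∈n , distinctᵇ⇒Unique dπ

Sym-Unique : ∀ n → Unique (Sym n)
Sym-Unique n = filterᵇ⁺ distinctᵇ (words-Unique n n)

∈-boolWords⁺ : ∀ {m w} → length w ≡ m → w ∈ boolWords m
∈-boolWords⁺ {zero}  {[]}        _   = here refl
∈-boolWords⁺ {suc m} {true ∷ w}  len = ∈-++⁺ˡ (∈-map⁺ (true ∷_) (∈-boolWords⁺ (suc-injective len)))
∈-boolWords⁺ {suc m} {false ∷ w} len =
  ∈-++⁺ʳ (map (true ∷_) (boolWords m)) (∈-map⁺ (false ∷_) (∈-boolWords⁺ (suc-injective len)))

∈-boolWords⁻ : ∀ {m w} → w ∈ boolWords m → length w ≡ m
∈-boolWords⁻ {zero}  (here refl) = refl
∈-boolWords⁻ {suc m} w∈ with ∈-++⁻ (map (true ∷_) (boolWords m)) w∈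
... | inj₁ w∈t with _ , w′∈ , refl ← ∈-map⁻ (true ∷_) w∈t  = cong suc (∈-boolWords⁻ w′∈)
... | inj₂ w∈f with _ , w′∈ , refl ← ∈-map⁻ (false ∷_) w∈f = cong suc (∈-boolWords⁻ w′∈)

boolWords-Unique : ∀ m → Unique (boolWords m)
boolWords-Unique zero    = [] ∷ []
boolWords-Unique (suc m) =
  ++⁺ (map⁺ ∷-injectiveʳ (boolWords-Unique m)) (map⁺ ∷-injectiveʳ (boolWords-Unique m)) disjoint
  where
  disjoint : ∀ {v} → v ∈ map (true ∷_) (boolWords m) × v ∈ map (false ∷_) (boolWords m) → ⊥
  disjoint (v∈t , v∈f) with _ , _ , refl ← ∈-map⁻ (true ∷_) v∈t | _ , _ , () ← ∈-map⁻ (false ∷_) v∈f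

Peak : (ℕ → ℕ) → ℕ → Set
Peak g u = g u < g (suc u) × g (suc (suc u)) < g (suc u)

peakIndicator≡0 : ∀ a b c → ¬ (a < b × c < b) → (if (a <ᵇ b) ∧ (c <ᵇ b) then 1 else 0) ≡ 0
peakIndicator≡0 a b c ¬peak with a <ᵇ b | <ᵇ-reflects-< a b | c <ᵇ b | <ᵇ-reflects-< c b
... | true  | ofʸ a<b | true  | ofʸ c<b = ⊥-elim (¬peak (a<b , c<b))
... | true  | _       | false | _       = refl
... | false | _       | _     | _       = refl

pk-applyUpTo≡0 : ∀ g n → (∀ u → ¬ Peak g u) → pk (applyUpTo g n) ≡ 0
pk-applyUpTo≡0 g zero                _     = refl
pk-applyUpTo≡0 g (suc zero)          _     = refl
pk-applyUpTo≡0 g (suc (suc zero))    _     = refl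
pk-applyUpTo≡0 g (suc (suc (suc n))) ¬peak =
  cong₂ _+_ (peakIndicator≡0 (g 0) (g 1) (g 2) (¬peak 0))
            (pk-applyUpTo≡0 (λ i → g (suc i)) (suc (suc n)) (λ u → ¬peak (suc u)))

pk-applyUpTo≡0⇒¬Peak : ∀ g n → pk (applyUpTo g n) ≡ 0 → ∀ u → suc (suc u) < n → ¬ Peak g u
pk-applyUpTo≡0⇒¬Peak g (suc (suc zero))    _    _       (s≤s (s≤s ()))
pk-applyUpTo≡0⇒¬Peak g (suc (suc (suc n))) pk≡0 zero _ (l , r)
  with g 0 <ᵇ g 1 | <ᵇ-reflects-< (g 0) (g 1) | g 2 <ᵇ g 1 | <ᵇ-reflects-< (g 2) (g 1)
... | true  | _        | true  | _        = 1+n≢0 pk≡0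
... | true  | _        | false | ofⁿ r≮  = r≮ r
... | false | ofⁿ l≮  | _     | _        = l≮ l
pk-applyUpTo≡0⇒¬Peak g (suc (suc (suc n))) pk≡0 (suc u) (s≤s u<n) =
  pk-applyUpTo≡0⇒¬Peak (λ i → g (suc i)) (suc (suc n)) (m+n≡0⇒n≡0 _ pk≡0) u u<n

ipk≡pk-applyUpTo : ∀ π → ipk π ≡ pk (applyUpTo (λ i → pos (suc i) π) (length π))
ipk≡pk-applyUpTo π =
  cong pk (trans (sym (map-∘ (upTo (length π)))) (map-upTo (λ i → pos (suc i) π) (length π)))

Peak-suc : ∀ {g h : ℕ → ℕ} → (∀ j → g j ≡ suc (h j)) → ∀ u → Peak g u ⇔ Peak h u
Peak-suc {g} {h} g≡1+h u =
  mk⇔ (λ (l , r) → ≤-pred (to-h l) , ≤-pred (to-h r)) (λ (l , r) → to-g (s≤s l) , to-g (s≤s r))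
  where
  to-h : ∀ {i j} → g i < g j → suc (h i) < suc (h j)
  to-h = subst₂ _<_ (g≡1+h _) (g≡1+h _)
  to-g : ∀ {i j} → suc (h i) < suc (h j) → g i < g j
  to-g = subst₂ _<_ (sym (g≡1+h _)) (sym (g≡1+h _))

rise-then-fall⇒Peak : ∀ (g : ℕ → ℕ) d {a b} → b ≡ d + suc a → g a < g (suc a) → g (suc b) < g b →
  (∀ j → a < j → j < b → g j ≢ g (suc j)) → ∃[ u ] a ≤ u × u < b × Peak g u
rise-then-fall⇒Peak g zero    {a} refl rise fall _ = a , ≤-refl , ≤-refl , rise , fall
rise-then-fall⇒Peak g (suc d) {a} refl rise fall distinct with g (suc (suc a)) <? g (suc a)
... | yes fall′ = a , ≤-refl , m≤n+m (suc a) (suc d) , rise , fall′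
... | no  ¬fall′
  with u , 1+a≤u , u<b , peak ← rise-then-fall⇒Peak g d (sym (+-suc d (suc a)))
         (≤∧≢⇒< (≮⇒≥ ¬fall′) (distinct (suc a) ≤-refl (s≤s (m≤n+m (suc a) d)))) fall
         (λ j 1+a<j → distinct j (<-trans (n<1+n a) 1+a<j))
  = u , ≤-trans (n≤1+n a) 1+a≤u , u<b , peak

peak-in-gap : ∀ (g : ℕ → ℕ) {t a b} → a < b → g a < t → g (suc b) < t →
  (∀ j → a < j → j ≤ b → t ≤ g j) → (∀ j → a < j → j < b → g j ≢ g (suc j)) →
  ∃[ u ] a ≤ u × u < b × Peak g u
peak-in-gap g {a = a} {b} a<b ga<t gb<t high distinct =
  rise-then-fall⇒Peak g (b ∸ suc a) (sym (m∸n+n≡m a<b))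
    (<-≤-trans ga<t (high (suc a) ≤-refl a<b)) (<-≤-trans gb<t (high b a<b ≤-refl)) distinct

_∈[_,_] : ℕ → ℕ → ℕ → Set
j ∈[ lo , hi ] = lo ≤ j × j ≤ hi

_∈[_,_]? : ∀ j lo hi → Dec (j ∈[ lo , hi ])
j ∈[ lo , hi ]? = lo ≤? j ×-dec j ≤? hi

∈[,]-convex : ∀ {lo hi u} → u ∈[ lo , hi ] → suc (suc u) ∈[ lo , hi ] → suc u ∈[ lo , hi ]
∈[,]-convex {u = u} (lo≤u , _) (_ , u+2≤hi) = ≤-trans lo≤u (n≤1+n u) , ≤-trans (n≤1+n (suc u)) u+2≤hi

module _ {lo hi : ℕ} {g g′ : ℕ → ℕ}
         (inside  : ∀ {j} → j ∈[ lo , hi ] → g j ≡ 0 × g′ j ≡ 0)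
         (outside : ∀ {j} → ¬ j ∈[ lo , hi ] → g j ≡ suc (g′ j)) where

  private
    positive⇒outside : ∀ {j} → 0 < g j ⊎ 0 < g′ j → ¬ j ∈[ lo , hi ]
    positive⇒outside (inj₁ 0<g)  j∈ = <-irrefl (sym (proj₁ (inside j∈))) 0<g
    positive⇒outside (inj₂ 0<g′) j∈ = <-irrefl (sym (proj₂ (inside j∈))) 0<g′

  Peak-shift⁻ : ∀ {u} → Peak g′ u → Peak g u
  Peak-shift⁻ {u} (l , r) = lower l , lower r
    where
    lower : ∀ {j} → g′ j < g′ (suc u) → g j < g (suc u)
    lower {j} lt rewrite outside (positive⇒outside (inj₂ (≤-<-trans z≤n l))) with j ∈[ lo , hi ]?
    ... | yes j∈ rewrite proj₁ (inside j∈) = s≤s z≤n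
    ... | no  j∉ rewrite outside j∉        = s≤s lt

  Peak-shift⁺ : ∀ {u} → Peak g u → Peak g′ u
  Peak-shift⁺ {u} (l , r) = raise l , raise r
    where
    mid∉ : ¬ suc u ∈[ lo , hi ]
    mid∉ = positive⇒outside (inj₁ (≤-<-trans z≤n l))
    -- If g′ vanished at the middle, g would be 1 there and 0 at both neighbours,
    -- which would then lie in the interval, and so would the middle.
    below-one⇒inside : ∀ {j} → g j < g (suc u) → g′ (suc u) ≡ 0 → j ∈[ lo , hi ]
    below-one⇒inside {j} lt g′≡0 with j ∈[ lo , hi ]?
    ... | yes j∈ = j∈
    ... | no  j∉ with s≤s () ← subst₂ _<_ (outside j∉) (trans (outside mid∉) (cong suc g′≡0)) lt
    0<g′mid : 0 < g′ (suc u)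
    0<g′mid with g′ (suc u) in g′≡
    ... | zero  = ⊥-elim (mid∉ (∈[,]-convex (below-one⇒inside l g′≡) (below-one⇒inside r g′≡)))
    ... | suc _ = s≤s z≤n
    raise : ∀ {j} → g j < g (suc u) → g′ j < g′ (suc u)
    raise {j} lt with j ∈[ lo , hi ]?
    ... | yes j∈ rewrite proj₂ (inside j∈) = 0<g′mid
    ... | no  j∉ = ≤-pred (subst₂ _<_ (outside j∉) (outside mid∉) lt)

  Peak-shift : ∀ u → Peak g u ⇔ Peak g′ u
  Peak-shift u = mk⇔ Peak-shift⁺ Peak-shift⁻

pos-head : ∀ y ρ → pos y (y ∷ ρ) ≡ 1
pos-head y ρ with y ≡ᵇ y | proof (y ≟ y)
... | true  | _        = refl
... | false | ofⁿ y≢y = ⊥-elim (y≢y refl)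

pos-∷-≢ : ∀ {j y} ρ → j ≢ y → pos j (y ∷ ρ) ≡ suc (pos j ρ)
pos-∷-≢ {j} {y} ρ j≢y with j ≡ᵇ y | proof (j ≟ y)
... | true  | ofʸ j≡y = ⊥-elim (j≢y j≡y)
... | false | _       = refl

pos-∈-positive : ∀ {j ρ} → j ∈ ρ → 1 ≤ pos j ρ
pos-∈-positive {j} {y ∷ ρ} _ with j ≡ᵇ y
... | true  = s≤s z≤n
... | false = s≤s z≤n

pos-injective : ∀ {j k ρ} → j ∈ ρ → k ∈ ρ → pos j ρ ≡ pos k ρ → j ≡ k
pos-injective {j} {k} {y ∷ ρ} j∈ k∈ eq with j ≡ᵇ y | proof (j ≟ y) | k ≡ᵇ y | proof (k ≟ y)
... | true  | ofʸ refl | true  | ofʸ refl = refl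
... | true  | _        | false | ofⁿ k≢y = ⊥-elim (<-irrefl (suc-injective eq) (pos-∈-positive (tail k≢y k∈)))
... | false | ofⁿ j≢y | true  | _        = ⊥-elim (<-irrefl (sym (suc-injective eq)) (pos-∈-positive (tail j≢y j∈)))
... | false | ofⁿ j≢y | false | ofⁿ k≢y = pos-injective (tail j≢y j∈) (tail k≢y k∈) (suc-injective eq)

-- The position function of a permutation x ∷ … ∷ ρ relative to its suffix ρ,
-- when the values already placed form the interval [lo, hi]: those sit at position 0.
posOutside : ℕ → ℕ → List ℕ → ℕ → ℕ
posOutside lo hi ρ j with j ∈[ lo , hi ]?
... | yes _ = 0
... | no  _ = pos j ρ

posOutside-inside : ∀ {lo hi j} ρ → j ∈[ lo , hi ] → posOutside lo hi ρ j ≡ 0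
posOutside-inside {lo} {hi} {j} ρ j∈ with j ∈[ lo , hi ]?
... | yes _  = refl
... | no  j∉ = ⊥-elim (j∉ j∈)

posOutside-outside : ∀ {lo hi j} ρ → ¬ j ∈[ lo , hi ] → posOutside lo hi ρ j ≡ pos j ρ
posOutside-outside {lo} {hi} {j} ρ j∉ with j ∈[ lo , hi ]?
... | yes j∈ = ⊥-elim (j∉ j∈)
... | no  _  = refl

pos-∷≡suc-posOutside : ∀ x ρ j → pos j (x ∷ ρ) ≡ suc (posOutside x x ρ j)
pos-∷≡suc-posOutside x ρ j with j ≟ x
... | yes refl = trans (pos-head j ρ) (cong suc (sym (posOutside-inside {x} {x} ρ (≤-refl , ≤-refl))))
... | no  j≢x  = trans (pos-∷-≢ ρ j≢x)
                   (cong suc (sym (posOutside-outside {x} {x} ρ (λ (x≤j , j≤x) → j≢x (≤-antisym j≤x x≤j)))))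

Extends : ℕ → ℕ → ℕ → ℕ → ℕ → Set
Extends lo hi y lo′ hi′ = ∀ {j} → j ∈[ lo′ , hi′ ] ⇔ (j ∈[ lo , hi ] ⊎ j ≡ y)

extends-up : ∀ {lo hi} → lo ≤ suc hi → Extends lo hi (suc hi) lo (suc hi)
extends-up {lo} {hi} lo≤1+hi {j} = mk⇔ to from
  where
  to : j ∈[ lo , suc hi ] → j ∈[ lo , hi ] ⊎ j ≡ suc hi
  to (lo≤j , j≤1+hi) with j ≟ suc hi
  ... | yes j≡ = inj₂ j≡
  ... | no  j≢ = inj₁ (lo≤j , ≤-pred (≤∧≢⇒< j≤1+hi j≢))
  from : j ∈[ lo , hi ] ⊎ j ≡ suc hi → j ∈[ lo , suc hi ]
  from (inj₁ (lo≤j , j≤hi)) = lo≤j , m≤n⇒m≤1+n j≤hi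
  from (inj₂ refl)          = lo≤1+hi , ≤-refl

extends-down : ∀ {l hi} → l ≤ hi → Extends (suc l) hi l l hi
extends-down {l} {hi} l≤hi {j} = mk⇔ to from
  where
  to : j ∈[ l , hi ] → j ∈[ suc l , hi ] ⊎ j ≡ l
  to (l≤j , j≤hi) with l ≟ j
  ... | yes l≡ = inj₂ (sym l≡)
  ... | no  l≢ = inj₁ (≤∧≢⇒< l≤j l≢ , j≤hi)
  from : j ∈[ suc l , hi ] ⊎ j ≡ l → j ∈[ l , hi ]
  from (inj₁ (l<j , j≤hi)) = <⇒≤ l<j , j≤hi
  from (inj₂ refl)         = ≤-refl , l≤hi

Peak-posOutside-extend : ∀ {lo hi y lo′ hi′} ρ → Extends lo hi y lo′ hi′ →
  ∀ u → Peak (posOutside lo hi (y ∷ ρ)) u ⇔ Peak (posOutside lo′ hi′ ρ) u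
Peak-posOutside-extend {lo} {hi} {y} {lo′} {hi′} ρ ext = Peak-shift inside outside
  where
  inside : ∀ {j} → j ∈[ lo , hi ] → posOutside lo hi (y ∷ ρ) j ≡ 0 × posOutside lo′ hi′ ρ j ≡ 0
  inside j∈ = posOutside-inside (y ∷ ρ) j∈ , posOutside-inside ρ (Equivalence.from ext (inj₁ j∈))
  outside : ∀ {j} → ¬ j ∈[ lo , hi ] → posOutside lo hi (y ∷ ρ) j ≡ suc (posOutside lo′ hi′ ρ j)
  outside {j} j∉ with j ≟ y
  ... | yes refl = trans (posOutside-outside (y ∷ ρ) j∉)
                     (trans (pos-head j ρ) (cong suc (sym (posOutside-inside ρ (Equivalence.from ext (inj₂ refl))))))
  ... | no  j≢y  = trans (posOutside-outside (y ∷ ρ) j∉)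
                     (trans (pos-∷-≢ ρ j≢y) (cong suc (sym (posOutside-outside ρ λ j∈′ →
                       [ j∉ , j≢y ]′ (Equivalence.to ext j∈′)))))

-- Encoding up/down words as permutations

downs : List Bool → ℕ
downs []          = 0
downs (true ∷ w)  = downs w
downs (false ∷ w) = suc (downs w)

ups : List Bool → ℕ
ups []          = 0
ups (true ∷ w)  = suc (ups w)
ups (false ∷ w) = ups w

downs+ups≡length : ∀ w → downs w + ups w ≡ length w
downs+ups≡length []          = refl
downs+ups≡length (true ∷ w)  = trans (+-suc (downs w) (ups w)) (cong suc (downs+ups≡length w))
downs+ups≡length (false ∷ w) = cong suc (downs+ups≡length w)

-- Continues a word whose values so far form the interval [lo, hi].
build : ℕ → ℕ → List Bool → List ℕ
build lo hi []          = []
build lo hi (true ∷ w)  = suc hi ∷ build lo (suc hi) w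
build lo hi (false ∷ w) = pred lo ∷ build (pred lo) hi w

encode : List Bool → List ℕ
encode w = suc (downs w) ∷ build (suc (downs w)) (suc (downs w)) w

length-build : ∀ lo hi w → length (build lo hi w) ≡ length w
length-build lo hi []          = refl
length-build lo hi (true ∷ w)  = cong suc (length-build lo (suc hi) w)
length-build lo hi (false ∷ w) = cong suc (length-build (pred lo) hi w)

<ᵇ-≡-true : ∀ {m n} → m < n → (m <ᵇ n) ≡ true
<ᵇ-≡-true m<n = Equivalence.to T-≡ (<⇒<ᵇ m<n)

<ᵇ-≡-false : ∀ {m n} → ¬ m < n → (m <ᵇ n) ≡ false
<ᵇ-≡-false {m} {n} m≮n with m <ᵇ n | <ᵇ-reflects-< m n
... | true  | ofʸ m<n = ⊥-elim (m≮n m<n)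
... | false | _       = refl

steps-build : ∀ w {lo hi x} → downs w < lo → x ∈[ lo , hi ] → steps (x ∷ build lo hi w) ≡ w
steps-build []                  _          _            = refl
steps-build (true ∷ w)          downs<lo   (lo≤x , x≤hi)
  rewrite <ᵇ-≡-true (s≤s x≤hi) = cong (true ∷_) (steps-build w downs<lo (≤-trans lo≤x (m≤n⇒m≤1+n x≤hi) , ≤-refl))
steps-build (false ∷ w) {suc l} (s≤s downs<l) (l<x , x≤hi)
  rewrite <ᵇ-≡-false (<-asym l<x) = cong (false ∷_) (steps-build w downs<l (≤-refl , ≤-trans (<⇒≤ l<x) x≤hi))

steps-encode : ∀ w → steps (encode w) ≡ w
steps-encode w = steps-build w ≤-refl (≤-refl , ≤-refl)

encode-injective : ∀ {v w} → encode v ≡ encode w → v ≡ w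
encode-injective {v} {w} eq = trans (sym (steps-encode v)) (trans (cong steps eq) (steps-encode w))

All-∉⇒≢ : ∀ {lo hi x ys} → All (λ y → ¬ y ∈[ lo , hi ]) ys → x ∈[ lo , hi ] → All (x ≢_) ys
All-∉⇒≢ ys∉ x∈ = All.map (λ y∉ x≡y → y∉ (subst (_∈[ _ , _ ]) x≡y x∈)) ys∉

build-avoids : ∀ w {lo hi} → downs w < lo → lo ≤ hi → All (λ y → ¬ y ∈[ lo , hi ]) (build lo hi w)
build-avoids []          _ _ = []
build-avoids (true ∷ w)  {lo} {hi} downs<lo lo≤hi =
  (λ (_ , 1+hi≤hi) → 1+n≰n 1+hi≤hi)
  ∷ All.map (λ y∉ (lo≤y , y≤hi) → y∉ (lo≤y , m≤n⇒m≤1+n y≤hi)) (build-avoids w downs<lo (m≤n⇒m≤1+n lo≤hi))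
build-avoids (false ∷ w) {suc l} (s≤s downs<l) l<hi =
  (λ (l<l , _) → 1+n≰n l<l)
  ∷ All.map (λ y∉ (l<y , y≤hi) → y∉ (<⇒≤ l<y , y≤hi)) (build-avoids w downs<l (<⇒≤ l<hi))

build-Unique : ∀ w {lo hi} → downs w < lo → lo ≤ hi → Unique (build lo hi w)
build-Unique []          _ _ = []
build-Unique (true ∷ w)  downs<lo lo≤hi =
  All-∉⇒≢ (build-avoids w downs<lo lo≤1+hi) (lo≤1+hi , ≤-refl) ∷ build-Unique w downs<lo lo≤1+hi
  where lo≤1+hi = m≤n⇒m≤1+n lo≤hi
build-Unique (false ∷ w) {suc l} (s≤s downs<l) l<hi =
  All-∉⇒≢ (build-avoids w downs<l (<⇒≤ l<hi)) (≤-refl , <⇒≤ l<hi) ∷ build-Unique w downs<l (<⇒≤ l<hi)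

build-bounds : ∀ w {lo hi} → downs w < lo → lo ≤ hi →
               All (λ y → lo ∸ downs w ≤ y × y ≤ hi + ups w) (build lo hi w)
build-bounds []          _ _ = []
build-bounds (true ∷ w)  {lo} {hi} downs<lo lo≤hi =
  (≤-trans (m∸n≤m lo (downs w)) (m≤n⇒m≤1+n lo≤hi) ,
   subst (suc hi ≤_) (sym (+-suc hi (ups w))) (s≤s (m≤m+n hi (ups w))))
  ∷ All.map (λ {y} (lower , upper) → lower , subst (y ≤_) (sym (+-suc hi (ups w))) upper)
            (build-bounds w downs<lo (m≤n⇒m≤1+n lo≤hi))
build-bounds (false ∷ w) {suc l} {hi} (s≤s downs<l) l<hi =
  (m∸n≤m l (downs w) , ≤-trans (<⇒≤ l<hi) (m≤m+n hi (ups w)))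
  ∷ build-bounds w downs<l (<⇒≤ l<hi)

encode-IsPerm : ∀ w → IsPerm (suc (length w)) (encode w)
encode-IsPerm w = cong suc (length-build x x w)
                , head-inRange ∷ All.map tail-inRange (build-bounds w ≤-refl ≤-refl)
                , All-∉⇒≢ (build-avoids w ≤-refl ≤-refl) (≤-refl , ≤-refl) ∷ build-Unique w ≤-refl ≤-refl
  where
  x = suc (downs w)
  downs≤length : downs w ≤ length w
  downs≤length = subst (downs w ≤_) (downs+ups≡length w) (m≤m+n (downs w) (ups w))
  head-inRange : InRange (suc (length w)) x
  head-inRange = s≤s z≤n , s≤s downs≤length
  tail-inRange : ∀ {y} → x ∸ downs w ≤ y × y ≤ x + ups w → InRange (suc (length w)) y
  tail-inRange {y} (lower , upper) =
    subst (_≤ y) (m+n∸n≡m 1 (downs w)) lower , subst (y ≤_) (cong suc (downs+ups≡length w)) upper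

posOutside-[] : ∀ lo hi j → posOutside lo hi [] j ≡ 0
posOutside-[] lo hi j with j ∈[ lo , hi ]?
... | yes _ = refl
... | no  _ = refl

build-¬Peak : ∀ w {lo hi} → downs w < lo → lo ≤ hi → ∀ u → ¬ Peak (posOutside lo hi (build lo hi w)) u
build-¬Peak []          {lo} {hi} _ _ u (l , _) =
  <-irrefl refl (subst₂ _<_ (posOutside-[] lo hi u) (posOutside-[] lo hi (suc u)) l)
build-¬Peak (true ∷ w)  downs<lo lo≤hi u =
  build-¬Peak w downs<lo lo≤1+hi u ∘ Equivalence.to (Peak-posOutside-extend _ (extends-up lo≤1+hi) u)
  where lo≤1+hi = m≤n⇒m≤1+n lo≤hi
build-¬Peak (false ∷ w) {suc l} (s≤s downs<l) l<hi u =
  build-¬Peak w downs<l (<⇒≤ l<hi) u ∘ Equivalence.to (Peak-posOutside-extend _ (extends-down (<⇒≤ l<hi)) u)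

ipk-encode : ∀ w → ipk (encode w) ≡ 0
ipk-encode w =
  trans (ipk≡pk-applyUpTo (encode w)) (pk-applyUpTo≡0 (λ i → pos (suc i) (encode w)) (length (encode w)) λ u →
    build-¬Peak w ≤-refl ≤-refl (suc u) ∘ Equivalence.to (Peak-suc (pos-∷≡suc-posOutside x (build x x w)) (suc u)))
  where x = suc (downs w)

-- Decoding permutations without inverse peaks

-- ρ is the unread suffix of a permutation of [N] without inverse peaks
-- whose entries read so far are exactly the values in [lo, hi].
record Placed (N lo hi : ℕ) (ρ : List ℕ) : Set where
  field
    1≤lo    : 1 ≤ lo
    lo≤hi   : lo ≤ hi
    hi≤N    : hi ≤ N
    unique  : Unique ρ
    inRange : All (InRange N) ρ
    avoids  : All (λ y → ¬ y ∈[ lo , hi ]) ρ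
    covers  : ∀ {j} → InRange N j → ¬ j ∈[ lo , hi ] → j ∈ ρ
    ¬peak   : ∀ u → 1 ≤ u → suc (suc u) ≤ N → ¬ Peak (posOutside lo hi ρ) u

placed-extend : ∀ {N lo hi y ρ lo′ hi′} → Placed N lo hi (y ∷ ρ) → Extends lo hi y lo′ hi′ →
                1 ≤ lo′ → lo′ ≤ hi′ → hi′ ≤ N → Placed N lo′ hi′ ρ
placed-extend {y = y} {ρ} p ext 1≤lo′ lo′≤hi′ hi′≤N = record
  { 1≤lo    = 1≤lo′
  ; lo≤hi   = lo′≤hi′
  ; hi≤N    = hi′≤N
  ; unique  = AllPairs.tail unique
  ; inRange = All.tail inRange
  ; avoids  = All.zipWith (λ (z∉ , y≢z) z∈′ → [ z∉ , y≢z ∘ sym ]′ (Equivalence.to ext z∈′))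
                          (All.tail avoids , AllPairs.head unique)
  ; covers  = λ j∈N j∉′ → tail (λ j≡y → j∉′ (Equivalence.from ext (inj₂ j≡y)))
                               (covers j∈N (λ j∈ → j∉′ (Equivalence.from ext (inj₁ j∈))))
  ; ¬peak   = λ u 1≤u u+2≤N → ¬peak u 1≤u u+2≤N ∘ Equivalence.from (Peak-posOutside-extend ρ ext u)
  }
  where open Placed p

placed-up : ∀ {N lo hi ρ} → Placed N lo hi (suc hi ∷ ρ) → Placed N lo (suc hi) ρ
placed-up p = placed-extend p (extends-up lo≤1+hi) 1≤lo lo≤1+hi (proj₂ (All.head inRange))
  where
  open Placed p
  lo≤1+hi = m≤n⇒m≤1+n lo≤hi

placed-down : ∀ {N l hi ρ} → Placed N (suc l) hi (l ∷ ρ) → Placed N l hi ρ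
placed-down p = placed-extend p (extends-down (<⇒≤ lo≤hi)) (proj₁ (All.head inRange)) (<⇒≤ lo≤hi) hi≤N
  where open Placed p

no-gap : ∀ {N lo hi y ρ} → Placed N lo hi (y ∷ ρ) → ∀ {a c} → suc (suc a) ≤ c → 1 ≤ a → c ≤ N →
         posOutside lo hi (y ∷ ρ) a < 2 → posOutside lo hi (y ∷ ρ) c < 2 →
         (∀ {j} → a < j → j < c → ¬ j ∈[ lo , hi ] × j ≢ y) → ⊥
no-gap {N} {lo} {hi} {y} {ρ} p {a} {suc b} (s≤s a<b) 1≤a c≤N ga<2 gc<2 between
  = let u , a≤u , u<b , peak = peak-in-gap g a<b ga<2 gc<2 high distinct
    in ¬peak u (≤-trans 1≤a a≤u) (≤-trans (s≤s u<b) c≤N) peak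
  where
  open Placed p
  g = posOutside lo hi (y ∷ ρ)
  member : ∀ {j} → a < j → j ≤ b → j ∈ ρ × g j ≡ pos j (y ∷ ρ)
  member {j} a<j j≤b = tail j≢y (covers (≤-trans 1≤a (<⇒≤ a<j) , ≤-trans (m≤n⇒m≤1+n j≤b) c≤N) j∉)
                     , posOutside-outside (y ∷ ρ) j∉
    where j∉ = proj₁ (between a<j (s≤s j≤b)) ; j≢y = proj₂ (between a<j (s≤s j≤b))
  high : ∀ j → a < j → j ≤ b → 2 ≤ g j
  high j a<j j≤b with j∈ρ , gj≡ ← member a<j j≤b =
    subst (2 ≤_) (sym (trans gj≡ (pos-∷-≢ ρ (proj₂ (between a<j (s≤s j≤b)))))) (s≤s (pos-∈-positive j∈ρ))
  distinct : ∀ j → a < j → j < b → g j ≢ g (suc j)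
  distinct j a<j j<b gj≡gj+1
    with j∈ρ , gj≡ ← member a<j (<⇒≤ j<b) | j+1∈ρ , gj+1≡ ← member (<-trans a<j (n<1+n j)) j<b =
    1+n≢n (sym (pos-injective (there j∈ρ) (there j+1∈ρ) (trans (sym gj≡) (trans gj≡gj+1 gj+1≡))))

gap-above : ∀ {N lo hi y ρ} → Placed N lo hi (y ∷ ρ) → suc (suc hi) ≤ y → ⊥
gap-above {y = y} {ρ} p hi+2≤y = no-gap p hi+2≤y (≤-trans 1≤lo lo≤hi) (proj₂ (All.head inRange))
  (subst (_< 2) (sym (posOutside-inside (y ∷ ρ) (lo≤hi , ≤-refl))) (s≤s z≤n))
  (subst (_< 2) (sym (trans (posOutside-outside (y ∷ ρ) (All.head avoids)) (pos-head y ρ))) ≤-refl)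
  λ hi<j j<y → (λ (_ , j≤hi) → <⇒≱ hi<j j≤hi) , <⇒≢ j<y
  where open Placed p

gap-below : ∀ {N lo hi y ρ} → Placed N lo hi (y ∷ ρ) → suc (suc y) ≤ lo → ⊥
gap-below {y = y} {ρ} p y+2≤lo = no-gap p y+2≤lo (proj₁ (All.head inRange)) (≤-trans lo≤hi hi≤N)
  (subst (_< 2) (sym (trans (posOutside-outside (y ∷ ρ) (All.head avoids)) (pos-head y ρ))) ≤-refl)
  (subst (_< 2) (sym (posOutside-inside (y ∷ ρ) (≤-refl , lo≤hi))) (s≤s z≤n))
  λ y<j j<lo → (λ (lo≤j , _) → <⇒≱ j<lo lo≤j) , >⇒≢ y<j
  where open Placed p

next-adjacent : ∀ {N lo hi y ρ} → Placed N lo hi (y ∷ ρ) → y ≡ suc hi ⊎ suc y ≡ lo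
next-adjacent {lo = lo} {hi} {y} p with y ≟ suc hi | suc y ≟ lo | lo ≤? y
... | yes y≡1+hi | _          | _        = inj₁ y≡1+hi
... | no  _      | yes 1+y≡lo | _        = inj₂ 1+y≡lo
... | no  y≢1+hi | no  _      | yes lo≤y =
  ⊥-elim (gap-above p (≤∧≢⇒< (≰⇒> (λ y≤hi → All.head (Placed.avoids p) (lo≤y , y≤hi))) (y≢1+hi ∘ sym)))
... | no  _      | no  1+y≢lo | no  lo≰y = ⊥-elim (gap-below p (≤∧≢⇒< (≰⇒> lo≰y) 1+y≢lo))

decode : ∀ {N lo hi ρ} → Placed N lo hi ρ → ∃[ w ] build lo hi w ≡ ρ × lo ≡ suc (downs w)
decode {N} {lo} {hi} {[]} p = [] , refl , ≤-antisym lo≤1 1≤lo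
  where
  open Placed p
  lo≤1 : lo ≤ 1
  lo≤1 with lo ≤? 1
  ... | yes lo≤1 = lo≤1
  ... | no  lo≰1 with () ← covers (≤-refl , ≤-trans 1≤lo (≤-trans lo≤hi hi≤N)) (λ (lo≤1 , _) → lo≰1 lo≤1)
decode {ρ = y ∷ ρ} p with next-adjacent p
... | inj₁ refl with w , refl , lo≡ ← decode (placed-up p)   = true ∷ w , refl , lo≡
... | inj₂ refl with w , refl , refl ← decode (placed-down p) = false ∷ w , refl , refl

ipk≡0⇒Placed : ∀ {N x ρ} → IsPerm N (x ∷ ρ) → ipk (x ∷ ρ) ≡ 0 → Placed N x x ρ
ipk≡0⇒Placed {N} {x} {ρ} (len , x∈N ∷ ρ∈N , x∉ρ ∷ uρ) ipk≡0 = record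
  { 1≤lo    = proj₁ x∈N
  ; lo≤hi   = ≤-refl
  ; hi≤N    = proj₂ x∈N
  ; unique  = uρ
  ; inRange = ρ∈N
  ; avoids  = All.map (λ x≢y (x≤y , y≤x) → x≢y (≤-antisym x≤y y≤x)) x∉ρ
  ; covers  = λ j∈N j∉ → tail (λ j≡x → j∉ (≤-reflexive (sym j≡x) , ≤-reflexive j≡x))
                              (range1-⊆ (x∉ρ ∷ uρ) (x∈N ∷ ρ∈N) len (∈-range1⁺ j∈N))
  ; ¬peak   = ¬peak
  }
  where
  ¬peak : ∀ u → 1 ≤ u → suc (suc u) ≤ N → ¬ Peak (posOutside x x ρ) u
  ¬peak (suc u) _ u+3≤N =
    pk-applyUpTo≡0⇒¬Peak (λ i → pos (suc i) (x ∷ ρ)) (length (x ∷ ρ)) (trans (sym (ipk≡pk-applyUpTo (x ∷ ρ))) ipk≡0)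
      u (subst (suc (suc (suc u)) ≤_) (sym len) u+3≤N)
    ∘ Equivalence.from (Peak-suc (pos-∷≡suc-posOutside x ρ) (suc u))

ipk≡0⇒encode : ∀ {m π} → IsPerm (suc m) π → ipk π ≡ 0 → ∃[ w ] length w ≡ m × π ≡ encode w
ipk≡0⇒encode {m} {x ∷ ρ} perm ipk≡0 with w , refl , refl ← decode (ipk≡0⇒Placed perm ipk≡0) =
  w , trans (sym (length-build _ _ w)) (suc-injective (proj₁ perm)) , refl

-- Counting permutations without inverse peaks

count-ipk≡0 : ∀ m (S : List ℕ → ℕ) k →
  countSym (suc m) (λ π → (S π ≡ᵇ k) ∧ (ipk π ≡ᵇ 0)) ≡ count (λ w → S (encode w) ≡ᵇ k) (boolWords m)
count-ipk≡0 m S k =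
  trans (Unique-⊆-⊇⇒length-≡ (filterᵇ⁺ P (Sym-Unique (suc m)))
                              (filterᵇ⁺ Q (map⁺ encode-injective (boolWords-Unique m)))
                              ipk≡0⊆encoded encoded⊆ipk≡0)
        (count-map Q encode (boolWords m))
  where
  P : List ℕ → Bool
  P π = (S π ≡ᵇ k) ∧ (ipk π ≡ᵇ 0)
  Q : List ℕ → Bool
  Q π = S π ≡ᵇ k
  ipk≡0⊆encoded : filterᵇ P (Sym (suc m)) ⊆ filterᵇ Q (map encode (boolWords m))
  ipk≡0⊆encoded π∈ with π∈Sym , Pπ ← ∈-filterᵇ⁻ P {Sym (suc m)} π∈ with Qπ , ipk≡ᵇ0 ← Equivalence.to T-∧ Pπ
    with w , len , refl ← ipk≡0⇒encode (∈-Sym⁻ {suc m} π∈Sym) (≡ᵇ⇒≡ _ 0 ipk≡ᵇ0) =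
    ∈-filterᵇ⁺ Q {map encode (boolWords m)} (∈-map⁺ encode (∈-boolWords⁺ len)) Qπ
  encoded⊆ipk≡0 : filterᵇ Q (map encode (boolWords m)) ⊆ filterᵇ P (Sym (suc m))
  encoded⊆ipk≡0 π∈ with π∈map , Qπ ← ∈-filterᵇ⁻ Q {map encode (boolWords m)} π∈
    with w , w∈ , refl ← ∈-map⁻ encode π∈map =
    ∈-filterᵇ⁺ P {Sym (suc m)}
      (∈-Sym⁺ {suc m} (subst (λ n → IsPerm (suc n) (encode w)) (∈-boolWords⁻ w∈) (encode-IsPerm w)))
      (Equivalence.from T-∧ (Qπ , ≡⇒≡ᵇ _ 0 (ipk-encode w)))

br-encode : ∀ w → br (encode w) ≡ blocks w
br-encode w = cong blocks (steps-encode w)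

udr-encode : ∀ w → udr (encode w) ≡ suc (blocksFrom true w)
udr-encode []          = refl
udr-encode (true ∷ w)  rewrite <ᵇ-≡-false (<-asym (n<1+n (suc (downs w)))) =
  trans (+-identityʳ _) (br-encode (true ∷ w))
udr-encode (false ∷ w) rewrite <ᵇ-≡-true (n<1+n (suc (downs w))) =
  trans (+-comm _ 1) (cong suc (br-encode (false ∷ w)))

proposition5p9 : (n k : ℕ) → 2 ≤ n →
    (countSym n (λ π → (br π ≡ᵇ k) ∧ (ipk π ≡ᵇ 0)) ≡ 2 * choosePred (n ∸ 2) k)
    × (countSym n (λ π → (br π ≡ᵇ k) ∧ (ipk π ≡ᵇ 0))
       ≡ 2 * countSym (n ∸ 1) (λ σ → (udr σ ≡ᵇ k) ∧ (ipk σ ≡ᵇ 0)))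
proposition5p9 (suc (suc m)) k (s≤s (s≤s z≤n)) = count-br , trans count-br (cong (2 *_) (sym count-udr))
  where
  count-br : countSym (suc (suc m)) (λ π → (br π ≡ᵇ k) ∧ (ipk π ≡ᵇ 0)) ≡ 2 * choosePred m k
  count-br = trans (count-ipk≡0 (suc m) br k)
               (trans (count-cong (λ w → cong (_≡ᵇ k) (br-encode w)) (boolWords (suc m))) (count-blocks m k))
  count-udr : countSym (suc m) (λ σ → (udr σ ≡ᵇ k) ∧ (ipk σ ≡ᵇ 0)) ≡ choosePred m k
  count-udr = trans (count-ipk≡0 m udr k)
                (trans (count-cong (λ w → cong (_≡ᵇ k) (udr-encode w)) (boolWords m)) (count-suc-blocksFrom true m k))
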